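{- Let $n\geq 3$, let $S_n$ be the symmetric group of degree $n$, and let $S=\{c_n=(1\ 2\ \cdots\ n),c_n^{ -1},(1\ 2)\}$. Then $\mathrm{Aut}(S_n,S)=\langle \mathrm{Inn}(\phi)\rangle$, where $\phi=(1\ 2)(3\ n)(4\ n-1)(5\ n-2)\cdots\in S_n$ is the permutation with $\phi(1)=2$, $\phi(2)=1$ and $\phi(i)=n+3-i$ for $3\le i\le n$, and $\mathrm{Inn}(\phi)$ is the inner automorphism of $S_n$ given by conjugation by $\phi$ ($x\mapsto \phi^{ -1}x\phi$).
   Context: For a group $G$ and a subset $S\subseteq G$, $\mathrm{Aut}(G,S)=\{\sigma\in\mathrm{Aut}(G): S^\sigma=S\}$, the group of automorphisms of $G$ fixing $S$ setwise. -}

module Defs where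

open import Data.Nat using (ℕ; zero; suc)
open import Data.Fin using (Fin; zero; suc)
open import Data.Fin.Permutation
  using (Permutation′; _⟨$⟩ʳ_; _≈_; _∘ₚ_; flip; id; transpose; lift₀; reverse; swap)
open import Data.Product using (Σ; _×_; ∃)
open import Data.Sum using (_⊎_)
open import Relation.Binary.PropositionalEquality using (_≡_)

-- The symmetric group S_n: permutations of Fin n = {0,…,n-1}
-- (the point i of the paper is the element i-1 of Fin n),
-- with equality _≈_ (pointwise), and product _∘ₚ_.
-- Convention of the stdlib: (π ∘ₚ ρ) ⟨$⟩ʳ i = ρ ⟨$⟩ʳ (π ⟨$⟩ʳ i),
-- i.e. π ∘ₚ ρ is "first π, then ρ" (right actions), so the paper's
-- product x y is  x ∘ₚ y  and  x^{-1} is  flip x.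
Sym : ℕ → Set
Sym = Permutation′

-- The n-cycle c_n = (1 2 … n), i.e. in 0-based points  i ↦ i+1 (mod n).
-- Recursively: c_{m+2} = (apply lift₀ c_{m+1}) then (swap points 0,1).
--   0 ↦ 0 ↦ 1;  suc i ↦ suc (c i);  last = suc m ↦ suc 0 = 1 ↦ 0.
cyc : ∀ n → Sym n
cyc zero             = id
cyc (suc zero)       = id
cyc (suc (suc m))    = lift₀ (cyc (suc m)) ∘ₚ transpose zero (suc zero)

tr12 : ∀ n → Sym n
tr12 zero          = id
tr12 (suc zero)    = id
tr12 (suc (suc m)) = transpose zero (suc zero)

-- In 0-based points for n = m+2: swap 0,1 and reverse the block {2,…,m+1}
-- (j ↦ n+1-j), which is exactly stdlib's  swap reverse.
-- (Values for n < 2 are irrelevant: the statement assumes n ≥ 3.)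
phi : ∀ n → Sym n
phi zero          = id
phi (suc zero)    = id
phi (suc (suc m)) = swap reverse

inn : ∀ {n} → Sym n → Sym n → Sym n
inn g x = flip g ∘ₚ x ∘ₚ g

iter : ∀ {A : Set} → ℕ → (A → A) → A → A
iter zero    f a = a
iter (suc k) f a = f (iter k f a)

record IsAut (n : ℕ) (σ : Sym n → Sym n) : Set where
  field
    cong       : ∀ {x y} → x ≈ y → σ x ≈ σ y
    homo       : ∀ x y → σ (x ∘ₚ y) ≈ σ x ∘ₚ σ y
    injective  : ∀ {x y} → σ x ≈ σ y → x ≈ y
    surjective : ∀ y → ∃ λ x → σ x ≈ y

InS : ∀ n → Sym n → Set
InS n x = (x ≈ cyc n) ⊎ (x ≈ flip (cyc n)) ⊎ (x ≈ tr12 n)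

FixesS : ∀ n → (Sym n → Sym n) → Set
FixesS n σ =
  (∀ x → InS n x → InS n (σ x)) ×
  (∀ y → InS n y → ∃ λ x → InS n x × σ x ≈ y)

-- An automorphism σ with S^σ = S fixes t = (1 2), the only involution in S (c² ≠ 1 as n ≥ 3),
-- and therefore sends c to c or to c⁻¹. Conjugation by φ fixes t and inverts c, so after
-- composing with Inn(φ) if necessary we may assume that σ fixes both c and t. Such an
-- endomorphism fixes every transposition: conjugating t by powers of c gives the adjacent
-- transpositions (i i+1), and these conjugate (1 2) into every (1 j) and then into every (i j).
-- Now σ x conjugates each transposition (a b) to σ (x (a b) x⁻¹) = (x(a) x(b)), the same as x does,
-- and for n ≥ 3 a permutation is determined by its conjugation action on transpositions; hence
-- σ x = x. Conversely Inn(φ) is an involution mapping S onto S, hence so is each of its powers.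

module Submission where

open import Defs
open import Data.Nat using (ℕ; zero; suc; _≤_; s≤s; 2+)
open import Data.Fin using (Fin; zero; suc; inject₁; fromℕ; opposite)
open import Data.Fin.Properties using (_≟_; opposite-involutive)
open import Data.Fin.Induction using (<-weakInduction)
open import Data.Fin.Permutation
  using (_⟨$⟩ʳ_; _⟨$⟩ˡ_; _≈_; _∘ₚ_; flip; id; transpose; inverseˡ; inverseʳ)
import Data.Fin.Permutation.Components as PC
open import Data.Product using (∃; ∃₂; _×_; _,_; proj₁)
open import Data.Sum using (_⊎_; inj₁; inj₂)
import Data.Sum as Sum
open import Function.Base using (_∘_)
open import Function.Bundles using (_⇔_; mk⇔; Injection)
open import Function.Properties.Inverse using (↔⇒↣)
open import Level using (0ℓ)
open import Relation.Binary.Bundles using (Setoid)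
open import Relation.Nullary using (¬_; Dec; yes; no; contradiction)
open import Relation.Nullary.Decidable using (dec-true; dec-false)
open import Relation.Binary.PropositionalEquality
  using (_≡_; _≢_; refl; sym; trans; cong; module ≡-Reasoning)
import Relation.Binary.Reasoning.Setoid as SetoidReasoning

iter-preserves : ∀ {ℓ} {A : Set} {P : A → Set ℓ} {f : A → A} →
                 (∀ {x} → P x → P (f x)) → ∀ k {x} → P x → P (iter k f x)
iter-preserves f-preserves zero    Px = Px
iter-preserves {P = P} {f} f-preserves (suc k) Px =
  f-preserves (iter-preserves {P = P} {f} f-preserves k Px)

iter-comm : ∀ {A : Set} (f : A → A) k x → iter k f (f x) ≡ f (iter k f x)
iter-comm f zero    x = refl
iter-comm f (suc k) x = cong f (iter-comm f k x)

module _ {ℓ} (S : Setoid 0ℓ ℓ) where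
  open Setoid S using (Carrier) renaming (_≈_ to _≈ₛ_; refl to ≈ₛ-refl)

  iter-involutive : {f : Carrier → Carrier} → (∀ x → f (f x) ≈ₛ x) → ∀ k x → iter k f (iter k f x) ≈ₛ x
  iter-involutive f-involutive zero    x = ≈ₛ-refl
  iter-involutive {f} f-involutive (suc k) x = begin
    f (iter k f (f (iter k f x)))  ≡⟨ cong f (iter-comm f k (iter k f x)) ⟩
    f (f (iter k f (iter k f x)))  ≈⟨ f-involutive _ ⟩
    iter k f (iter k f x)          ≈⟨ iter-involutive f-involutive k x ⟩
    x                              ∎
    where open SetoidReasoning S

transpose-matchˡ : ∀ {n} (i j : Fin n) → PC.transpose i j i ≡ j
transpose-matchˡ i j rewrite dec-true (i ≟ i) refl = refl

transpose-matchʳ : ∀ {n} (i j : Fin n) → PC.transpose i j j ≡ i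
transpose-matchʳ i j with j ≟ i
... | yes j≡i = j≡i
... | no _ rewrite dec-true (j ≟ j) refl = refl

transpose-other : ∀ {n} {i j k : Fin n} → k ≢ i → k ≢ j → PC.transpose i j k ≡ k
transpose-other {i = i} {j} {k} k≢i k≢j
  rewrite dec-false (k ≟ i) k≢i | dec-false (k ≟ j) k≢j = refl

Sym-setoid : ℕ → Setoid 0ℓ 0ℓ
Sym-setoid n = record
  { Carrier       = Sym n
  ; _≈_           = _≈_
  ; isEquivalence = record
      { refl  = λ _ → refl
      ; sym   = λ x≈y i → sym (x≈y i)
      ; trans = λ x≈y y≈z i → trans (x≈y i) (y≈z i)
      }
  }

module _ {n : ℕ} where

  ⟨$⟩ʳ-injective : (g : Sym n) {i j : Fin n} → g ⟨$⟩ʳ i ≡ g ⟨$⟩ʳ j → i ≡ j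
  ⟨$⟩ʳ-injective g = Injection.injective (↔⇒↣ g)

  ∘ₚ-cong : {x x′ y y′ : Sym n} → x ≈ x′ → y ≈ y′ → x ∘ₚ y ≈ x′ ∘ₚ y′
  ∘ₚ-cong {x′ = x′} {y} x≈x′ y≈y′ i = trans (cong (y ⟨$⟩ʳ_) (x≈x′ i)) (y≈y′ (x′ ⟨$⟩ʳ i))

  flip-cong : {x y : Sym n} → x ≈ y → flip x ≈ flip y
  flip-cong {x} {y} x≈y i = begin
    x ⟨$⟩ˡ i                    ≡⟨ inverseˡ y ⟨
    y ⟨$⟩ˡ (y ⟨$⟩ʳ (x ⟨$⟩ˡ i))  ≡⟨ cong (y ⟨$⟩ˡ_) (x≈y _) ⟨
    y ⟨$⟩ˡ (x ⟨$⟩ʳ (x ⟨$⟩ˡ i))  ≡⟨ cong (y ⟨$⟩ˡ_) (inverseʳ x) ⟩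
    y ⟨$⟩ˡ i                    ∎
    where open ≡-Reasoning

  flip-square≈id : {x : Sym n} → flip x ∘ₚ flip x ≈ id → x ∘ₚ x ≈ id
  flip-square≈id {x} sq i = begin
    x ⟨$⟩ʳ (x ⟨$⟩ʳ i)                              ≡⟨ sq _ ⟨
    x ⟨$⟩ˡ (x ⟨$⟩ˡ (x ⟨$⟩ʳ (x ⟨$⟩ʳ i)))            ≡⟨ cong (x ⟨$⟩ˡ_) (inverseˡ x) ⟩
    x ⟨$⟩ˡ (x ⟨$⟩ʳ i)                              ≡⟨ inverseˡ x ⟩
    i                                              ∎
    where open ≡-Reasoning

  inn-cong : {g g′ x x′ : Sym n} → g ≈ g′ → x ≈ x′ → inn g x ≈ inn g′ x′
  inn-cong {g} {g′} {x} {x′} g≈g′ x≈x′ =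
    ∘ₚ-cong {flip g} {flip g′} {x ∘ₚ g} {x′ ∘ₚ g′}
      (flip-cong {g} {g′} g≈g′) (∘ₚ-cong {x} {x′} {g} {g′} x≈x′ g≈g′)

  inn-homo : (g x y : Sym n) → inn g (x ∘ₚ y) ≈ inn g x ∘ₚ inn g y
  inn-homo g x y i = cong (λ j → g ⟨$⟩ʳ (y ⟨$⟩ʳ j)) (sym (inverseˡ g))

  inn-inn : (g h x : Sym n) → inn g (inn h x) ≈ inn (h ∘ₚ g) x
  inn-inn g h x _ = refl

  inn-id : (x : Sym n) → inn id x ≈ x
  inn-id x _ = refl

  transpose-comm : (a b : Fin n) → transpose a b ≈ transpose b a
  transpose-comm a b i = by-cases (i ≟ a) (i ≟ b)
    where
    -- `with i ≟ a` would also abstract the test inside PC.transpose and block the match lemmas.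
    by-cases : Dec (i ≡ a) → Dec (i ≡ b) → PC.transpose a b i ≡ PC.transpose b a i
    by-cases (yes refl) _          = trans (transpose-matchˡ a b) (sym (transpose-matchʳ b a))
    by-cases (no _)     (yes refl) = trans (transpose-matchʳ a b) (sym (transpose-matchˡ b a))
    by-cases (no i≢a)   (no i≢b)   = trans (transpose-other i≢a i≢b) (sym (transpose-other i≢b i≢a))

  transpose-≈⇒≡⊎≡ : {p q r s : Fin n} → p ≢ q → transpose p q ≈ transpose r s → p ≡ r ⊎ p ≡ s
  transpose-≈⇒≡⊎≡ {p} {q} {r} {s} p≢q τ≈τ′ with p ≟ r | p ≟ s
  ... | yes p≡r | _       = inj₁ p≡r
  ... | no _    | yes p≡s = inj₂ p≡s
  ... | no p≢r  | no p≢s  =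
    contradiction (trans (sym (transpose-matchˡ p q)) (trans (τ≈τ′ p) (transpose-other p≢r p≢s))) (p≢q ∘ sym)

  map-transpose : (g : Sym n) (a b i : Fin n) →
                  g ⟨$⟩ʳ PC.transpose a b i ≡ PC.transpose (g ⟨$⟩ʳ a) (g ⟨$⟩ʳ b) (g ⟨$⟩ʳ i)
  map-transpose g a b i = by-cases (i ≟ a) (i ≟ b)
    where
    a′ b′ : Fin n
    a′ = g ⟨$⟩ʳ a
    b′ = g ⟨$⟩ʳ b
    by-cases : Dec (i ≡ a) → Dec (i ≡ b) → g ⟨$⟩ʳ PC.transpose a b i ≡ PC.transpose a′ b′ (g ⟨$⟩ʳ i)
    by-cases (yes refl) _          = trans (cong (g ⟨$⟩ʳ_) (transpose-matchˡ a b)) (sym (transpose-matchˡ a′ b′))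
    by-cases (no _)     (yes refl) = trans (cong (g ⟨$⟩ʳ_) (transpose-matchʳ a b)) (sym (transpose-matchʳ a′ b′))
    by-cases (no i≢a)   (no i≢b)   =
      trans (cong (g ⟨$⟩ʳ_) (transpose-other i≢a i≢b))
            (sym (transpose-other (i≢a ∘ ⟨$⟩ʳ-injective g) (i≢b ∘ ⟨$⟩ʳ-injective g)))

  inn-transpose : (g : Sym n) {a b a′ b′ : Fin n} → g ⟨$⟩ʳ a ≡ a′ → g ⟨$⟩ʳ b ≡ b′ →
                  inn g (transpose a b) ≈ transpose a′ b′
  inn-transpose g {a} {b} refl refl i =
    trans (map-transpose g a b (g ⟨$⟩ˡ i)) (cong (PC.transpose _ _) (inverseʳ g))

two-others : ∀ {m} (a : Fin (suc (2+ m))) → ∃₂ λ b d → a ≢ b × a ≢ d × b ≢ d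
two-others zero          = suc zero , suc (suc zero) , (λ ()) , (λ ()) , (λ ())
two-others (suc zero)    = zero , suc (suc zero) , (λ ()) , (λ ()) , (λ ())
two-others (suc (suc _)) = zero , suc zero , (λ ()) , (λ ()) , (λ ())

inn-transpose-≈⇒≡⊎≡ : ∀ {n} {x y : Sym n} {a c : Fin n} → a ≢ c →
  inn y (transpose a c) ≈ inn x (transpose a c) → y ⟨$⟩ʳ a ≡ x ⟨$⟩ʳ a ⊎ y ⟨$⟩ʳ a ≡ x ⟨$⟩ʳ c
inn-transpose-≈⇒≡⊎≡ {x = x} {y} {a} {c} a≢c same = transpose-≈⇒≡⊎≡ (a≢c ∘ ⟨$⟩ʳ-injective y) (begin
  transpose (y ⟨$⟩ʳ a) (y ⟨$⟩ʳ c)  ≈⟨ inn-transpose y refl refl ⟨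
  inn y (transpose a c)            ≈⟨ same ⟩
  inn x (transpose a c)            ≈⟨ inn-transpose x refl refl ⟩
  transpose (x ⟨$⟩ʳ a) (x ⟨$⟩ʳ c)  ∎)
  where open SetoidReasoning (Sym-setoid _)

-- y a lies in both {x a, x b} and {x a, x d}; this is where n ≥ 3 is needed.
inn-injective-on-transpositions : ∀ {m} {x y : Sym (suc (2+ m))} →
  (∀ a b → a ≢ b → inn y (transpose a b) ≈ inn x (transpose a b)) → y ≈ x
inn-injective-on-transpositions {x = x} {y} same a with two-others a
... | b , d , a≢b , a≢d , b≢d
    with inn-transpose-≈⇒≡⊎≡ {x = x} {y} a≢b (same a b a≢b)
       | inn-transpose-≈⇒≡⊎≡ {x = x} {y} a≢d (same a d a≢d)
...   | inj₁ ya≡xa | _          = ya≡xa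
...   | inj₂ _     | inj₁ ya≡xa = ya≡xa
...   | inj₂ ya≡xb | inj₂ ya≡xd = contradiction (⟨$⟩ʳ-injective x (trans (sym ya≡xb) ya≡xd)) b≢d

record IsEndomorphism {n : ℕ} (σ : Sym n → Sym n) : Set where
  field
    ⟦⟧-cong : ∀ {x y} → x ≈ y → σ x ≈ σ y
    homo : ∀ x y → σ (x ∘ₚ y) ≈ σ x ∘ₚ σ y

IsAut⇒IsEndomorphism : ∀ {n} {σ : Sym n → Sym n} → IsAut n σ → IsEndomorphism σ
IsAut⇒IsEndomorphism aut = record { ⟦⟧-cong = IsAut.cong aut ; homo = IsAut.homo aut }

inn-isEndomorphism : ∀ {n} (g : Sym n) → IsEndomorphism (inn g)
inn-isEndomorphism g = record
  { ⟦⟧-cong = λ {x} {y} → inn-cong {g = g} {g} {x} {y} (λ _ → refl)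
  ; homo = inn-homo g
  }

∘-isEndomorphism : ∀ {n} {σ τ : Sym n → Sym n} →
                   IsEndomorphism σ → IsEndomorphism τ → IsEndomorphism (τ ∘ σ)
∘-isEndomorphism {σ = σ} {τ} σ-endo τ-endo = record
  { ⟦⟧-cong = λ {x} {y} → IsEndomorphism.⟦⟧-cong τ-endo ∘ IsEndomorphism.⟦⟧-cong σ-endo {x} {y}
  ; homo = λ x y → begin
      τ (σ (x ∘ₚ y))      ≈⟨ IsEndomorphism.⟦⟧-cong τ-endo (IsEndomorphism.homo σ-endo x y) ⟩
      τ (σ x ∘ₚ σ y)      ≈⟨ IsEndomorphism.homo τ-endo (σ x) (σ y) ⟩
      τ (σ x) ∘ₚ τ (σ y)  ∎
  }
  where open SetoidReasoning (Sym-setoid _)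

Fixed : ∀ {n} → (Sym n → Sym n) → Sym n → Set
Fixed σ x = σ x ≈ x

module IsEndomorphismProperties {n : ℕ} {σ : Sym n → Sym n} (endo : IsEndomorphism σ) where
  open IsEndomorphism endo

  preserves-id : σ id ≈ id
  preserves-id i = begin
    e ⟨$⟩ʳ i                     ≡⟨ inverseˡ e ⟨
    e ⟨$⟩ˡ (e ⟨$⟩ʳ (e ⟨$⟩ʳ i))  ≡⟨ cong (e ⟨$⟩ˡ_) (e≈e∘e i) ⟨
    e ⟨$⟩ˡ (e ⟨$⟩ʳ i)           ≡⟨ inverseˡ e ⟩
    i                            ∎
    where
    open ≡-Reasoning
    e : Sym n
    e = σ id
    e≈e∘e : e ≈ e ∘ₚ e
    e≈e∘e i = trans (⟦⟧-cong {id} {id ∘ₚ id} (λ _ → refl) i) (homo id id i)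

  preserves-flip : ∀ g → σ (flip g) ≈ flip (σ g)
  preserves-flip g i = begin
    σ (flip g) ⟨$⟩ʳ i                              ≡⟨ inverseˡ (σ g) ⟨
    σ g ⟨$⟩ˡ (σ g ⟨$⟩ʳ (σ (flip g) ⟨$⟩ʳ i))       ≡⟨ cong (σ g ⟨$⟩ˡ_) σg∘σg⁻¹ ⟩
    σ g ⟨$⟩ˡ i                                     ∎
    where
    open ≡-Reasoning
    σg∘σg⁻¹ : σ g ⟨$⟩ʳ (σ (flip g) ⟨$⟩ʳ i) ≡ i
    σg∘σg⁻¹ = trans (sym (homo (flip g) g i))
                (trans (⟦⟧-cong {flip g ∘ₚ g} {id} (λ _ → inverseʳ g) i) (preserves-id i))

  preserves-inn : ∀ g x → σ (inn g x) ≈ inn (σ g) (σ x)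
  preserves-inn g x = begin
    σ (inn g x)                    ≈⟨ homo (flip g) (x ∘ₚ g) ⟩
    σ (flip g) ∘ₚ σ (x ∘ₚ g)       ≈⟨ ∘ₚ-cong {x = σ (flip g)} {flip (σ g)} {σ (x ∘ₚ g)} {σ x ∘ₚ σ g}
                                        (preserves-flip g) (homo x g) ⟩
    inn (σ g) (σ x)                ∎
    where open SetoidReasoning (Sym-setoid n)

  preserves-involution : ∀ {x} → x ∘ₚ x ≈ id → σ x ∘ₚ σ x ≈ id
  preserves-involution {x} x²≈id = begin
    σ x ∘ₚ σ x  ≈⟨ homo x x ⟨
    σ (x ∘ₚ x)  ≈⟨ ⟦⟧-cong {x ∘ₚ x} {id} x²≈id ⟩
    σ id        ≈⟨ preserves-id ⟩
    id          ∎
    where open SetoidReasoning (Sym-setoid n)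

  Fixed-resp : ∀ {x y} → x ≈ y → Fixed σ x → Fixed σ y
  Fixed-resp {x} {y} x≈y σx≈x = begin
    σ y  ≈⟨ ⟦⟧-cong {y} {x} (λ i → sym (x≈y i)) ⟩
    σ x  ≈⟨ σx≈x ⟩
    x    ≈⟨ x≈y ⟩
    y    ∎
    where open SetoidReasoning (Sym-setoid n)

  Fixed-inn : ∀ {g x} → Fixed σ g → Fixed σ x → Fixed σ (inn g x)
  Fixed-inn {g} {x} σg≈g σx≈x = begin
    σ (inn g x)      ≈⟨ preserves-inn g x ⟩
    inn (σ g) (σ x)  ≈⟨ inn-cong {g = σ g} {g} {σ x} {x} σg≈g σx≈x ⟩
    inn g x          ∎
    where open SetoidReasoning (Sym-setoid n)

fixes-transpositions⇒≈id : ∀ {m} {σ : Sym (suc (2+ m)) → Sym (suc (2+ m))} → IsEndomorphism σ →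
  (∀ a b → a ≢ b → Fixed σ (transpose a b)) → ∀ x → σ x ≈ x
fixes-transpositions⇒≈id {σ = σ} endo fixed x =
  inn-injective-on-transpositions {x = x} {σ x} λ a b a≢b → begin
  inn (σ x) (transpose a b)       ≈⟨ inn-cong {g = σ x} {σ x} {transpose a b} {σ (transpose a b)}
                                       (λ _ → refl) (λ i → sym (fixed a b a≢b i)) ⟩
  inn (σ x) (σ (transpose a b))   ≈⟨ preserves-inn x (transpose a b) ⟨
  σ (inn x (transpose a b))       ≈⟨ Fixed-resp
                                       (λ i → sym (inn-transpose x refl refl i))
                                       (fixed _ _ (a≢b ∘ ⟨$⟩ʳ-injective x)) ⟩
  inn x (transpose a b)           ∎
  where
  open IsEndomorphismProperties endo
  open SetoidReasoning (Sym-setoid _)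

cyc-inject₁ : ∀ m (i : Fin (suc m)) → cyc (2+ m) ⟨$⟩ʳ inject₁ i ≡ suc i
cyc-inject₁ m       zero    = refl
cyc-inject₁ (suc m) (suc i) = cong (PC.transpose zero (suc zero) ∘ suc) (cyc-inject₁ m i)

module _ {m : ℕ} {σ : Sym (2+ m) → Sym (2+ m)} (endo : IsEndomorphism σ)
         (σt≈t : Fixed σ (tr12 (2+ m))) (σc≈c : Fixed σ (cyc (2+ m))) where
  open IsEndomorphismProperties endo

  fixes-adjacent-transpose : ∀ i → Fixed σ (transpose (inject₁ i) (suc i))
  fixes-adjacent-transpose = <-weakInduction (λ i → Fixed σ (transpose (inject₁ i) (suc i))) σt≈t step
    where
    step : ∀ i → Fixed σ (transpose (inject₁ (inject₁ i)) (suc (inject₁ i))) →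
           Fixed σ (transpose (suc (inject₁ i)) (suc (suc i)))
    step i fixed = Fixed-resp
      (inn-transpose (cyc _) (cyc-inject₁ m (inject₁ i)) (cyc-inject₁ m (suc i)))
      (Fixed-inn σc≈c fixed)

  fixes-transpose-zero : ∀ i → Fixed σ (transpose zero (suc i))
  fixes-transpose-zero = <-weakInduction (λ i → Fixed σ (transpose zero (suc i))) σt≈t step
    where
    step : ∀ i → Fixed σ (transpose zero (suc (inject₁ i))) → Fixed σ (transpose zero (suc (suc i)))
    step i fixed = Fixed-resp
      (inn-transpose g refl (transpose-matchˡ (suc (inject₁ i)) (suc (suc i))))
      (Fixed-inn (fixes-adjacent-transpose (suc i)) fixed)
      where
      g : Sym (2+ m)
      g = transpose (suc (inject₁ i)) (suc (suc i))

  fixes-transpose : ∀ a b → a ≢ b → Fixed σ (transpose a b)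
  fixes-transpose zero    zero    0≢0 = contradiction refl 0≢0
  fixes-transpose zero    (suc j) _   = fixes-transpose-zero j
  fixes-transpose (suc i) zero    _   = Fixed-resp (transpose-comm zero (suc i)) (fixes-transpose-zero i)
  fixes-transpose (suc i) (suc j) i≢j = Fixed-resp
    (inn-transpose g (transpose-matchˡ zero (suc i)) (transpose-other {i = zero} {suc i} (λ ()) (i≢j ∘ sym)))
    (Fixed-inn (fixes-transpose-zero i) (fixes-transpose-zero j))
    where
    g : Sym (2+ m)
    g = transpose zero (suc i)

fixes-generators⇒≈id : ∀ {m} {σ : Sym (suc (2+ m)) → Sym (suc (2+ m))} → IsEndomorphism σ →
  Fixed σ (tr12 _) → Fixed σ (cyc _) → ∀ x → σ x ≈ x
fixes-generators⇒≈id endo σt≈t σc≈c = fixes-transpositions⇒≈id endo (fixes-transpose endo σt≈t σc≈c)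

cyc-last : ∀ m → cyc (2+ m) ⟨$⟩ʳ fromℕ (suc m) ≡ zero
cyc-last zero    = refl
cyc-last (suc m) = cong (PC.transpose zero (suc zero) ∘ suc) (cyc-last m)

flip-phi : ∀ m → flip (phi (2+ m)) ≈ phi (2+ m)
flip-phi m zero          = refl
flip-phi m (suc zero)    = refl
flip-phi m (suc (suc i)) = refl

phi-involutive : ∀ m → phi (2+ m) ∘ₚ phi (2+ m) ≈ id
phi-involutive m zero          = refl
phi-involutive m (suc zero)    = refl
phi-involutive m (suc (suc i)) = cong (λ j → suc (suc j)) (opposite-involutive i)

-- φ ∘ₚ c is the reflection i ↦ 2 − i (mod n) of the n-gon.
phi-cyc-involutive : ∀ m → (phi (suc (2+ m)) ∘ₚ cyc _) ∘ₚ (phi _ ∘ₚ cyc _) ≈ id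
phi-cyc-involutive m       zero                = cyc-last (suc m)
phi-cyc-involutive m       (suc zero)          = refl
phi-cyc-involutive m       (suc (suc zero))    = cong (λ i → cyc _ ⟨$⟩ʳ (phi _ ⟨$⟩ʳ i)) (cyc-last (suc m))
phi-cyc-involutive (suc m) (suc (suc (suc k))) = begin
  c ⟨$⟩ʳ (p ⟨$⟩ʳ (c ⟨$⟩ʳ inject₁ (suc (suc (opposite k)))))
    ≡⟨ cong (λ i → c ⟨$⟩ʳ (p ⟨$⟩ʳ i)) (cyc-inject₁ (2+ m) (suc (suc (opposite k)))) ⟩
  c ⟨$⟩ʳ inject₁ (suc (suc (opposite (opposite k))))
    ≡⟨ cong (λ i → c ⟨$⟩ʳ inject₁ (suc (suc i))) (opposite-involutive k) ⟩
  c ⟨$⟩ʳ inject₁ (suc (suc k))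
    ≡⟨ cyc-inject₁ (2+ m) (suc (suc k)) ⟩
  suc (suc (suc k)) ∎
  where
  open ≡-Reasoning
  c p : Sym (suc (suc (2+ m)))
  c = cyc _
  p = phi _

inn-phi-tr12 : ∀ m → inn (phi (2+ m)) (tr12 _) ≈ tr12 _
inn-phi-tr12 m zero          = refl
inn-phi-tr12 m (suc zero)    = refl
inn-phi-tr12 m (suc (suc i)) = phi-involutive m (suc (suc i))

inn-phi-cyc : ∀ m → inn (phi (suc (2+ m))) (cyc _) ≈ flip (cyc _)
inn-phi-cyc m i = begin
  p ⟨$⟩ʳ (c ⟨$⟩ʳ (flip p ⟨$⟩ʳ i))                ≡⟨ cong (λ j → p ⟨$⟩ʳ (c ⟨$⟩ʳ j)) (flip-phi (suc m) i) ⟩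
  p ⟨$⟩ʳ (c ⟨$⟩ʳ (p ⟨$⟩ʳ i))                     ≡⟨ inverseˡ c ⟨
  c ⟨$⟩ˡ (c ⟨$⟩ʳ (p ⟨$⟩ʳ (c ⟨$⟩ʳ (p ⟨$⟩ʳ i))))  ≡⟨ cong (c ⟨$⟩ˡ_) (phi-cyc-involutive m i) ⟩
  c ⟨$⟩ˡ i                                       ∎
  where
  open ≡-Reasoning
  c p : Sym (suc (2+ m))
  c = cyc _
  p = phi _

inn-phi-flip-cyc : ∀ m → inn (phi (suc (2+ m))) (flip (cyc _)) ≈ cyc _
inn-phi-flip-cyc m = begin
  inn p (flip c)  ≈⟨ IsEndomorphismProperties.preserves-flip (inn-isEndomorphism p) c ⟩
  flip (inn p c)  ≈⟨ flip-cong {x = inn p c} {flip c} (inn-phi-cyc m) ⟩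
  flip (flip c)   ≡⟨⟩
  c               ∎
  where
  open SetoidReasoning (Sym-setoid _)
  c p : Sym (suc (2+ m))
  c = cyc _
  p = phi _

inn-phi-involutive : ∀ m x → inn (phi (2+ m)) (inn (phi _) x) ≈ x
inn-phi-involutive m x = begin
  inn p (inn p x)  ≈⟨ inn-inn p p x ⟩
  inn (p ∘ₚ p) x   ≈⟨ inn-cong {g = p ∘ₚ p} {id} {x} {x} (phi-involutive m) (λ _ → refl) ⟩
  inn id x         ≈⟨ inn-id x ⟩
  x                ∎
  where
  open SetoidReasoning (Sym-setoid _)
  p : Sym (2+ m)
  p = phi _

InS-resp : ∀ {n} {x y : Sym n} → x ≈ y → InS n x → InS n y
InS-resp {n} {x} {y} x≈y = Sum.map (resp {cyc n}) (Sum.map (resp {flip (cyc n)}) (resp {tr12 n}))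
  where
  resp : ∀ {z} → x ≈ z → y ≈ z
  resp x≈z i = trans (sym (x≈y i)) (x≈z i)

inn-phi-InS : ∀ {m} {x : Sym (suc (2+ m))} → InS _ x → InS _ (inn (phi _) x)
inn-phi-InS {m} {x} = image
  where
  c t p : Sym (suc (2+ m))
  c = cyc _
  t = tr12 _
  p = phi _
  via : ∀ {y z} → x ≈ y → inn p y ≈ z → inn p x ≈ z
  via {y} x≈y py≈z i = trans (inn-cong {g = p} {p} {x} {y} (λ _ → refl) x≈y i) (py≈z i)
  image : InS _ x → InS _ (inn p x)
  image (inj₁ x≈c)          = inj₂ (inj₁ (via {c} {flip c} x≈c (inn-phi-cyc m)))
  image (inj₂ (inj₁ x≈c⁻¹)) = inj₁ (via {flip c} {c} x≈c⁻¹ (inn-phi-flip-cyc m))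
  image (inj₂ (inj₂ x≈t))   = inj₂ (inj₂ (via {t} {t} x≈t (inn-phi-tr12 (suc m))))

cyc-square≉id : ∀ m → ¬ (cyc (suc (2+ m)) ∘ₚ cyc _ ≈ id)
cyc-square≉id m c²≈id = contradiction (c²≈id zero) λ ()

cyc≉tr12 : ∀ m → ¬ (cyc (suc (2+ m)) ≈ tr12 _)
cyc≉tr12 m c≈t = contradiction (c≈t (suc zero)) λ ()

tr12-involutive : ∀ m → tr12 (2+ m) ∘ₚ tr12 _ ≈ id
tr12-involutive m zero          = refl
tr12-involutive m (suc zero)    = refl
tr12-involutive m (suc (suc i)) = refl

InS-involution⇒tr12 : ∀ {m} {x : Sym (suc (2+ m))} → InS _ x → x ∘ₚ x ≈ id → x ≈ tr12 _
InS-involution⇒tr12 {m} {x} (inj₁ x≈c) x²≈id = contradiction c²≈id (cyc-square≉id m)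
  where
  c²≈id : cyc _ ∘ₚ cyc _ ≈ id
  c²≈id i = trans (sym (∘ₚ-cong {x = x} {cyc _} {x} {cyc _} x≈c x≈c i)) (x²≈id i)
InS-involution⇒tr12 {m} {x} (inj₂ (inj₁ x≈c⁻¹)) x²≈id =
  contradiction (flip-square≈id {x = cyc _} c⁻²≈id) (cyc-square≉id m)
  where
  c⁻²≈id : flip (cyc _) ∘ₚ flip (cyc _) ≈ id
  c⁻²≈id i = trans (sym (∘ₚ-cong {x = x} {flip (cyc _)} {x} {flip (cyc _)} x≈c⁻¹ x≈c⁻¹ i)) (x²≈id i)
InS-involution⇒tr12 (inj₂ (inj₂ x≈t)) _ = x≈t

inverts-cyc⇒≈inn-phi : ∀ {m} {σ : Sym (suc (2+ m)) → Sym (suc (2+ m))} → IsEndomorphism σ →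
  Fixed σ (tr12 _) → σ (cyc _) ≈ flip (cyc _) → ∀ x → σ x ≈ inn (phi _) x
inverts-cyc⇒≈inn-phi {m} {σ} endo σt≈t σc≈c⁻¹ x = begin
  σ x                  ≈⟨ inn-phi-involutive (suc m) (σ x) ⟨
  inn p (inn p (σ x))  ≈⟨ inn-cong {g = p} {p} {inn p (σ x)} {x} (λ _ → refl)
                            (fixes-generators⇒≈id pσ-endo pσt≈t pσc≈c x) ⟩
  inn p x              ∎
  where
  open SetoidReasoning (Sym-setoid _)
  c t p : Sym (suc (2+ m))
  c = cyc _
  t = tr12 _
  p = phi _
  pσ-endo : IsEndomorphism (inn p ∘ σ)
  pσ-endo = ∘-isEndomorphism endo (inn-isEndomorphism p)
  pσt≈t : inn p (σ t) ≈ t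
  pσt≈t i = trans (inn-cong {g = p} {p} {σ t} {t} (λ _ → refl) σt≈t i) (inn-phi-tr12 (suc m) i)
  pσc≈c : inn p (σ c) ≈ c
  pσc≈c i = trans (inn-cong {g = p} {p} {σ c} {flip c} (λ _ → refl) σc≈c⁻¹ i) (inn-phi-flip-cyc m i)

module _ {m : ℕ} {σ : Sym (suc (2+ m)) → Sym (suc (2+ m))} where
  private
    c t p : Sym (suc (2+ m))
    c = cyc _
    t = tr12 _
    p = phi _

  FixesS⇒fixes-tr12 : IsAut _ σ → FixesS _ σ → Fixed σ t
  FixesS⇒fixes-tr12 aut (maps-into , _) =
    InS-involution⇒tr12 {x = σ t} (maps-into t (inj₂ (inj₂ (λ _ → refl))))
      (IsEndomorphismProperties.preserves-involution (IsAut⇒IsEndomorphism aut) (tr12-involutive (suc m)))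

  FixesS⇒cyc-image : IsAut _ σ → FixesS _ σ → Fixed σ c ⊎ σ c ≈ flip c
  FixesS⇒cyc-image aut fixes with proj₁ fixes c (inj₁ (λ _ → refl))
  ... | inj₁ σc≈c          = inj₁ σc≈c
  ... | inj₂ (inj₁ σc≈c⁻¹) = inj₂ σc≈c⁻¹
  ... | inj₂ (inj₂ σc≈t)   = contradiction (IsAut.injective aut σc≈σt) (cyc≉tr12 m)
    where
    σc≈σt : σ c ≈ σ t
    σc≈σt i = trans (σc≈t i) (sym (FixesS⇒fixes-tr12 aut fixes i))

  FixesS⇒inner-power : IsAut _ σ → FixesS _ σ → ∃ λ k → ∀ x → σ x ≈ iter k (inn p) x
  FixesS⇒inner-power aut fixes with FixesS⇒fixes-tr12 aut fixes | FixesS⇒cyc-image aut fixes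
  ... | σt≈t | inj₁ σc≈c   = 0 , fixes-generators⇒≈id (IsAut⇒IsEndomorphism aut) σt≈t σc≈c
  ... | σt≈t | inj₂ σc≈c⁻¹ = 1 , inverts-cyc⇒≈inn-phi (IsAut⇒IsEndomorphism aut) σt≈t σc≈c⁻¹

  inner-power⇒FixesS : (∃ λ k → ∀ x → σ x ≈ iter k (inn p) x) → FixesS _ σ
  inner-power⇒FixesS (k , σ≈pᵏ) = maps-into , covers
    where
    pᵏ-InS : ∀ {x} → InS _ x → InS _ (iter k (inn p) x)
    pᵏ-InS = iter-preserves {P = InS _} {inn p} (λ {x} → inn-phi-InS {m} {x}) k
    maps-into : ∀ x → InS _ x → InS _ (σ x)
    maps-into x x∈S = InS-resp {x = iter k (inn p) x} {σ x} (λ i → sym (σ≈pᵏ x i)) (pᵏ-InS x∈S)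
    covers : ∀ y → InS _ y → ∃ λ x → InS _ x × σ x ≈ y
    covers y y∈S = iter k (inn p) y , pᵏ-InS y∈S ,
      λ i → trans (σ≈pᵏ _ i) (iter-involutive (Sym-setoid _) (inn-phi-involutive (suc m)) k y i)

lemma2p7 : (n : ℕ) → 3 ≤ n → (σ : Sym n → Sym n) → IsAut n σ →
    (FixesS n σ ⇔ (∃ λ k → ∀ x → σ x ≈ iter k (inn (phi n)) x))
lemma2p7 (suc (suc (suc m))) (s≤s (s≤s (s≤s _))) σ aut =
  mk⇔ (FixesS⇒inner-power aut) (inner-power⇒FixesS {σ = σ})
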